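{- Let $A_1=\{231,312,4321,21543\}$ and $A_2=\{231,321,4123,21534\}$. For all $n\ge 1$, $$|\operatorname{Av}_n(A_1)|=|\operatorname{Av}_n(A_2)|=F_{n+1}-1,$$ where $F_n$ denotes the Fibonacci numbers with $F_0=F_1=1$ and $F_{n}=F_{n-1}+F_{n-2}$.
   Context: For a set $S$ of permutations, $\operatorname{Av}_n(S)$ is the set of permutations of length $n$ that avoid every pattern in $S$ (classical pattern avoidance). -}

module Defs where

open import Data.Nat using (ℕ; zero; suc; _+_; _∸_)
open import Data.Fin using (Fin; _<_)
open import Data.Vec using (Vec; lookup)
open import Data.List using (List)
open import Data.List.Relation.Unary.All using (All)
open import Data.Product using (Σ; ∃; _×_; _,_)
open import Relation.Nullary using (¬_)
open import Function.Definitions using (Injective)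
open import Relation.Binary.PropositionalEquality using (_≡_)
open import Function.Bundles using (_↔_)

F : ℕ → ℕ
F zero = 1
F (suc zero) = 1
F (suc (suc n)) = F (suc n) + F n

IsPerm : ∀ {n} → Vec (Fin n) n → Set
IsPerm v = Injective _≡_ _≡_ (lookup v)

Pattern : Set
Pattern = Σ ℕ λ k → Vec (Fin k) k

Contains : ∀ {n} → Vec (Fin n) n → Pattern → Set
Contains {n} π (k , σ) =
  ∃ λ (f : Fin k → Fin n) →
    (∀ i j → i < j → f i < f j) ×
    (∀ i j → (lookup π (f i) < lookup π (f j) → lookup σ i < lookup σ j)
           × (lookup σ i < lookup σ j → lookup π (f i) < lookup π (f j)))

Avoids : ∀ {n} → Vec (Fin n) n → List Pattern → Set
Avoids π S = All (λ σ → ¬ Contains π σ) S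

-- Proof fields are irrelevant, so elements are equal iff their one-line
-- notations are equal; |Av_n(S)| = k is expressed as Av n S ↔ Fin k.
record Av (n : ℕ) (S : List Pattern) : Set where
  constructor mkAv
  field
    perm : Vec (Fin n) n
    .isPerm : IsPerm perm
    .avoids : Avoids perm S

-- Patterns written in one-line notation, 0-based values.
open import Data.List using (_∷_; [])
open import Data.Vec using (_∷_; [])
open import Data.Fin using (zero; suc)

p231 p312 p321 p4321 p4123 p21543 p21534 : Pattern
p231 = 3 , (suc zero ∷ suc (suc zero) ∷ zero ∷ [])
p312 = 3 , (suc (suc zero) ∷ zero ∷ suc zero ∷ [])
p321 = 3 , (suc (suc zero) ∷ suc zero ∷ zero ∷ [])
p4321 = 4 , (suc (suc (suc zero)) ∷ suc (suc zero) ∷ suc zero ∷ zero ∷ [])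
p4123 = 4 , (suc (suc (suc zero)) ∷ zero ∷ suc zero ∷ suc (suc zero) ∷ [])
p21543 = 5 , (suc zero ∷ zero ∷ suc (suc (suc (suc zero))) ∷ suc (suc (suc zero)) ∷ suc (suc zero) ∷ [])
p21534 = 5 , (suc zero ∷ zero ∷ suc (suc (suc (suc zero))) ∷ suc (suc zero) ∷ suc (suc (suc zero)) ∷ [])

A₁ A₂ : List Pattern
A₁ = p231 ∷ p312 ∷ p4321 ∷ p21543 ∷ []
A₂ = p231 ∷ p321 ∷ p4123 ∷ p21534 ∷ []

module Submission where

-- Av(231, 312) consists of the layered permutations, direct sums of decreasing blocks, and in
-- an avoider of 231 and 321 every block has the form (k-1) 0 1 … (k-2).  The patterns 4321,
-- resp. 4123, allow only the first blocks 1, 21, 321, resp. 1, 21, 312.  After a first block 1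
-- the rest is an arbitrary member of the class.  Since 21543 = 21 ⊕ 321 and 21534 = 21 ⊕ 312,
-- after a longer first block the rest must avoid D = {231, 312, 321}, whose members are direct
-- sums of blocks 1 and 21 and are therefore counted by F n.  Hence
-- a (n + 1) = a n + F (n - 1) + F (n - 2), with terms of negative index read as 0, and
-- a n = F (n + 1) - 1 follows by induction.

open import Defs
open import Data.Nat using (ℕ; suc; _∸_; _≥_)
open import Data.Fin using (Fin)
open import Data.Product using (_×_)
open import Function.Bundles using (_↔_)

open import Data.Empty using (⊥)
open import Data.Empty.Irrelevant using () renaming (⊥-elim to ⊥-elim-irr)
open import Data.Fin as Fin
  using (zero; suc; toℕ; _↑ˡ_; _↑ʳ_; inject₁; opposite; reduce≥; fromℕ<; _<_; _≤_)
open import Data.Fin.Patterns using (0F; 1F; 2F; 3F; 4F)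
import Data.Fin.Properties as Fin
open import Data.List using (List; _∷_; [])
open import Data.List.Relation.Unary.All as All using () renaming ([] to []ᴬ; _∷_ to _∷ᴬ_)
open import Data.Nat as ℕ using (zero; _+_; z≤n; s≤s; z<s; s<s)
import Data.Nat.Properties as ℕ
open import Data.Product using (∃; _,_; proj₁; proj₂)
open import Data.Sum as Sum using (_⊎_; inj₁; inj₂)
open import Data.Sum.Function.Propositional using (_⊎-↔_)
open import Data.Vec using (Vec; []; _∷_; lookup; map; _++_; tabulate)
import Data.Vec.Properties as Vec
open import Function using (_∘_; id)
open import Function.Bundles using (mk↔ₛ′)
open import Function.Properties.Inverse using (↔-trans; ↔-sym)
open import Relation.Binary using (tri<; tri≈; tri>)
open import Relation.Binary.PropositionalEquality
open import Relation.Nullary using (¬_; yes; no; contradiction)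
open import Relation.Nullary.Decidable using (recompute)

-- Occurrences

Perm : ℕ → Set
Perm n = Vec (Fin n) n

Increasing : ∀ {m n} → (Fin m → Fin n) → Set
Increasing f = ∀ i j → i < j → f i < f j

Occurrence : ∀ {m n} → Perm n → Perm m → (Fin m → Fin n) → Set
Occurrence π p f =
  Increasing f ×
  (∀ i j → (lookup π (f i) < lookup π (f j) → lookup p i < lookup p j)
         × (lookup p i < lookup p j → lookup π (f i) < lookup π (f j)))

increasing-by-steps : ∀ {m n} (h : Fin (suc m) → Fin n) →
  (∀ a → h (inject₁ a) < h (suc a)) → Increasing h
increasing-by-steps {m} h step i j i<j = below (toℕ j) j refl i<j
  where
  below : ∀ t (j : Fin (suc m)) → toℕ j ≡ t → toℕ i ℕ.< t → h i < h j
  below (suc t) (suc j) j≡1+t (s≤s i≤t) with ℕ.m≤n⇒m<n∨m≡n i≤t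
  ... | inj₁ i<t = ℕ.<-trans (below t (inject₁ j) (trans (Fin.toℕ-inject₁ j) (ℕ.suc-injective j≡1+t)) i<t) (step j)
  ... | inj₂ i≡t = subst (λ x → h x < h (suc j)) (sym i≡j) (step j)
    where
    i≡j : i ≡ inject₁ j
    i≡j = Fin.toℕ-injective (trans i≡t (trans (sym (ℕ.suc-injective j≡1+t)) (sym (Fin.toℕ-inject₁ j))))

increasing-monotone : ∀ {m n} {f : Fin m → Fin n} → Increasing f → ∀ {i j} → i ≤ j → f i ≤ f j
increasing-monotone {f = f} f↑ {i} {j} i≤j with ℕ.m≤n⇒m<n∨m≡n i≤j
... | inj₁ i<j = ℕ.<⇒≤ (f↑ i j i<j)
... | inj₂ i≡j = ℕ.≤-reflexive (cong (toℕ ∘ f) (Fin.toℕ-injective i≡j))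

increasing-reflects-< : ∀ {m n} {f : Fin m → Fin n} → Increasing f → ∀ {i j} → f i < f j → i < j
increasing-reflects-< {f = f} f↑ {i} {j} fi<fj with Fin.<-cmp i j
... | tri< i<j _ _ = i<j
... | tri≈ _ refl _ = contradiction fi<fj (ℕ.<-irrefl refl)
... | tri> _ _ j<i = contradiction (f↑ j i j<i) (ℕ.<-asym fi<fj)

increasing-inflationary : ∀ {m n} {f : Fin m → Fin n} → Increasing f → ∀ i → toℕ i ℕ.≤ toℕ (f i)
increasing-inflationary {m} {f = f} f↑ i = go (toℕ i) i refl
  where
  go : ∀ t (i : Fin m) → toℕ i ≡ t → t ℕ.≤ toℕ (f i)
  go zero    i       _     = z≤n
  go (suc t) (suc i) i≡1+t = ℕ.≤-<-trans
    (go t (inject₁ i) (trans (Fin.toℕ-inject₁ i) (ℕ.suc-injective i≡1+t)))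
    (f↑ (inject₁ i) (suc i) (ℕ.≤-reflexive (cong suc (Fin.toℕ-inject₁ i))))

opposite-reverses-< : ∀ {n} {i j : Fin n} → i < j → opposite j < opposite i
opposite-reverses-< {i = i} {j} i<j =
  subst₂ ℕ._<_ (sym (Fin.opposite-prop j)) (sym (Fin.opposite-prop i)) (ℕ.∸-monoʳ-< (s<s i<j) (Fin.toℕ<n j))

-- Conjugating f by opposite turns the lower bound i ≤ f i into the upper bound f i ≤ i.
increasing-endo-id : ∀ {n} {f : Fin n → Fin n} → Increasing f → ∀ i → f i ≡ i
increasing-endo-id {n} {f} f↑ i = Fin.≤-antisym (ℕ.≮⇒≥ i≮fi) (increasing-inflationary f↑ i)
  where
  f̃↑ : Increasing (opposite ∘ f ∘ opposite)
  f̃↑ a b a<b = opposite-reverses-< (f↑ _ _ (opposite-reverses-< a<b))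
  i≮fi : ¬ (i < f i)
  i≮fi i<fi = ℕ.<-irrefl refl (ℕ.<-≤-trans (opposite-reverses-< i<fi) opp-i≤opp-fi)
    where
    opp-i≤opp-fi : toℕ (opposite i) ℕ.≤ toℕ (opposite (f i))
    opp-i≤opp-fi = subst (λ x → toℕ (opposite i) ℕ.≤ toℕ (opposite (f x)))
      (Fin.opposite-involutive i) (increasing-inflationary f̃↑ (opposite i))

occurrence-refl : ∀ {m} (p : Perm m) → Occurrence p p id
occurrence-refl p = (λ _ _ → id) , λ _ _ → id , id

occurrence-∘ : ∀ {l m n} {π : Perm n} {p : Perm m} {q : Perm l} {f h} →
  Occurrence π p f → Occurrence p q h → Occurrence π q (f ∘ h)
occurrence-∘ (f↑ , f≅) (h↑ , h≅) =
  (λ i j i<j → f↑ _ _ (h↑ i j i<j)) ,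
  λ i j → proj₁ (h≅ i j) ∘ proj₁ (f≅ _ _) , proj₂ (f≅ _ _) ∘ proj₂ (h≅ i j)

occurrence-∘⁻ : ∀ {l m n} {π : Perm n} {τ : Perm m} {p : Perm l} {ι g} →
  Occurrence π τ ι → Occurrence π p (ι ∘ g) → Occurrence τ p g
occurrence-∘⁻ (ι↑ , ι≅) (ιg↑ , ιg≅) =
  (λ i j i<j → increasing-reflects-< ι↑ (ιg↑ i j i<j)) ,
  λ i j → proj₁ (ιg≅ i j) ∘ proj₂ (ι≅ _ _) , proj₁ (ι≅ _ _) ∘ proj₂ (ιg≅ i j)

occurrence-cong : ∀ {m n} {π : Perm n} {p : Perm m} {f g} →
  (∀ i → f i ≡ g i) → Occurrence π p f → Occurrence π p g
occurrence-cong {π = π} f≗g (f↑ , f≅) =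
  (λ i j i<j → subst₂ _<_ (f≗g i) (f≗g j) (f↑ i j i<j)) ,
  λ i j → proj₁ (f≅ i j) ∘ subst₂ (λ a b → lookup π a < lookup π b) (sym (f≗g i)) (sym (f≗g j)) ,
          subst₂ (λ a b → lookup π a < lookup π b) (f≗g i) (f≗g j) ∘ proj₂ (f≅ i j)

contains-trans : ∀ {l m n} {π : Perm n} {p : Perm m} {q : Perm l} →
  Contains π (m , p) → Contains p (l , q) → Contains π (l , q)
contains-trans {π = π} {p} {q} (f , πf) (h , ph) = f ∘ h , occurrence-∘ {π = π} {p} {q} πf ph

avoids-sub : ∀ {n} (σ : Perm n) (P Q : Pattern) → Contains (proj₂ P) Q → ¬ Contains σ Q → ¬ Contains σ P
avoids-sub σ (_ , p) (_ , q) Q-in-P no-Q P-in-σ = no-Q (contains-trans {π = σ} {p} {q} P-in-σ Q-in-P)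

-- p⁻¹ lists the positions of p by increasing value, so only consecutive values need comparing.
occurrence-via-inverse : ∀ {m n} (π : Perm n) (p p⁻¹ : Perm (suc m)) {f : Fin (suc m) → Fin n} →
  (∀ i → lookup p⁻¹ (lookup p i) ≡ i) → Increasing f →
  (∀ a → lookup π (f (lookup p⁻¹ (inject₁ a))) < lookup π (f (lookup p⁻¹ (suc a)))) →
  Occurrence π p f
occurrence-via-inverse {m} {n} π p p⁻¹ {f} p⁻¹∘p f↑ steps =
  f↑ , λ i j → (increasing-reflects-< g↑ ∘ subst₂ _<_ (πf≡g∘p i) (πf≡g∘p j)) ,
               (subst₂ _<_ (sym (πf≡g∘p i)) (sym (πf≡g∘p j)) ∘ g↑ _ _)
  where
  g : Fin (suc m) → Fin n
  g v = lookup π (f (lookup p⁻¹ v))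
  g↑ : Increasing g
  g↑ = increasing-by-steps g steps
  πf≡g∘p : ∀ i → lookup π (f i) ≡ g (lookup p i)
  πf≡g∘p i = cong (λ x → lookup π (f x)) (sym (p⁻¹∘p i))

avoids-same-length : ∀ {m} (τ p : Perm m) (i j : Fin m) →
  lookup p i < lookup p j → ¬ (lookup τ i < lookup τ j) → ¬ Contains τ (m , p)
avoids-same-length τ p i j pi<pj τi≮τj (f , f↑ , f≅) = τi≮τj
  (subst₂ (λ a b → lookup τ a < lookup τ b) (increasing-endo-id f↑ i) (increasing-endo-id f↑ j)
    (proj₂ (f≅ i j) pi<pj))

increasing₃ : ∀ {n} {a b c : Fin n} → a < b → b < c → Increasing (lookup (a ∷ b ∷ c ∷ []))
increasing₃ a<b b<c = increasing-by-steps _ λ { 0F → a<b ; 1F → b<c }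

increasing₄ : ∀ {n} {a b c d : Fin n} → a < b → b < c → c < d → Increasing (lookup (a ∷ b ∷ c ∷ d ∷ []))
increasing₄ a<b b<c c<d = increasing-by-steps _ λ { 0F → a<b ; 1F → b<c ; 2F → c<d }

p21 : Perm 2
p21 = 1F ∷ 0F ∷ []

module _ {n} (π : Perm n) where
  private
    π⟨_⟩ : Fin n → Fin n
    π⟨ i ⟩ = lookup π i

  contains-21 : ∀ {a b} → a < b → π⟨ b ⟩ < π⟨ a ⟩ → Contains π (2 , p21)
  contains-21 {a} {b} a<b b<a = lookup (a ∷ b ∷ []) , occurrence-via-inverse π p21 p21
    (λ { 0F → refl ; 1F → refl }) (increasing-by-steps _ λ { 0F → a<b }) λ { 0F → b<a }

  contains-231 : ∀ {a b c} → a < b → b < c → π⟨ c ⟩ < π⟨ a ⟩ → π⟨ a ⟩ < π⟨ b ⟩ → Contains π p231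
  contains-231 a<b b<c c<a a<b′ = _ , occurrence-via-inverse π (proj₂ p231) (2F ∷ 0F ∷ 1F ∷ [])
    (λ { 0F → refl ; 1F → refl ; 2F → refl }) (increasing₃ a<b b<c) λ { 0F → c<a ; 1F → a<b′ }

  contains-312 : ∀ {a b c} → a < b → b < c → π⟨ b ⟩ < π⟨ c ⟩ → π⟨ c ⟩ < π⟨ a ⟩ → Contains π p312
  contains-312 a<b b<c b<c′ c<a = _ , occurrence-via-inverse π (proj₂ p312) (1F ∷ 2F ∷ 0F ∷ [])
    (λ { 0F → refl ; 1F → refl ; 2F → refl }) (increasing₃ a<b b<c) λ { 0F → b<c′ ; 1F → c<a }

  contains-321 : ∀ {a b c} → a < b → b < c → π⟨ c ⟩ < π⟨ b ⟩ → π⟨ b ⟩ < π⟨ a ⟩ → Contains π p321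
  contains-321 a<b b<c c<b b<a = _ , occurrence-via-inverse π (proj₂ p321) (2F ∷ 1F ∷ 0F ∷ [])
    (λ { 0F → refl ; 1F → refl ; 2F → refl }) (increasing₃ a<b b<c) λ { 0F → c<b ; 1F → b<a }

  contains-4321 : ∀ {a b c d} → a < b → b < c → c < d →
    π⟨ d ⟩ < π⟨ c ⟩ → π⟨ c ⟩ < π⟨ b ⟩ → π⟨ b ⟩ < π⟨ a ⟩ → Contains π p4321
  contains-4321 a<b b<c c<d d<c c<b b<a = _ , occurrence-via-inverse π (proj₂ p4321) (3F ∷ 2F ∷ 1F ∷ 0F ∷ [])
    (λ { 0F → refl ; 1F → refl ; 2F → refl ; 3F → refl }) (increasing₄ a<b b<c c<d)
    λ { 0F → d<c ; 1F → c<b ; 2F → b<a }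

  contains-4123 : ∀ {a b c d} → a < b → b < c → c < d →
    π⟨ b ⟩ < π⟨ c ⟩ → π⟨ c ⟩ < π⟨ d ⟩ → π⟨ d ⟩ < π⟨ a ⟩ → Contains π p4123
  contains-4123 a<b b<c c<d b<c′ c<d′ d<a = _ , occurrence-via-inverse π (proj₂ p4123) (1F ∷ 2F ∷ 3F ∷ 0F ∷ [])
    (λ { 0F → refl ; 1F → refl ; 2F → refl ; 3F → refl }) (increasing₄ a<b b<c c<d)
    λ { 0F → b<c′ ; 1F → c<d′ ; 2F → d<a }

321-in-4321 : Contains (proj₂ p4321) p321
321-in-4321 = contains-321 (proj₂ p4321) {1F} {2F} {3F} (s<s z<s) (s<s (s<s z<s)) z<s (s<s z<s)

312-in-4123 : Contains (proj₂ p4123) p312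
312-in-4123 = contains-312 (proj₂ p4123) {0F} {2F} {3F} z<s (s<s (s<s z<s)) (s<s z<s) (s<s (s<s z<s))

321-in-21543 : Contains (proj₂ p21543) p321
321-in-21543 = contains-321 (proj₂ p21543) {2F} {3F} {4F} (s<s (s<s z<s)) (s<s (s<s (s<s z<s)))
  (s<s (s<s z<s)) (s<s (s<s (s<s z<s)))

312-in-21534 : Contains (proj₂ p21534) p312
312-in-21534 = contains-312 (proj₂ p21534) {2F} {3F} {4F} (s<s (s<s z<s)) (s<s (s<s (s<s z<s)))
  (s<s (s<s z<s)) (s<s (s<s (s<s z<s)))

-- Direct sums

_⊕_ : ∀ {k n} → Perm k → Perm n → Perm (k + n)
_⊕_ {k} {n} τ σ = map (_↑ˡ n) τ ++ map (k ↑ʳ_) σ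

module _ {k n : ℕ} where

  ↑ˡ-mono-< : {a b : Fin k} → a < b → a ↑ˡ n < b ↑ˡ n
  ↑ˡ-mono-< {a} {b} = subst₂ ℕ._<_ (sym (Fin.toℕ-↑ˡ a n)) (sym (Fin.toℕ-↑ˡ b n))

  ↑ˡ-cancel-< : {a b : Fin k} → a ↑ˡ n < b ↑ˡ n → a < b
  ↑ˡ-cancel-< {a} {b} = subst₂ ℕ._<_ (Fin.toℕ-↑ˡ a n) (Fin.toℕ-↑ˡ b n)

  ↑ʳ-mono-< : {a b : Fin n} → a < b → k ↑ʳ a < k ↑ʳ b
  ↑ʳ-mono-< {a} {b} = subst₂ ℕ._<_ (sym (Fin.toℕ-↑ʳ k a)) (sym (Fin.toℕ-↑ʳ k b)) ∘ ℕ.+-monoʳ-< k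

  ↑ʳ-cancel-< : {a b : Fin n} → k ↑ʳ a < k ↑ʳ b → a < b
  ↑ʳ-cancel-< {a} {b} = ℕ.+-cancelˡ-< k _ _ ∘ subst₂ ℕ._<_ (Fin.toℕ-↑ʳ k a) (Fin.toℕ-↑ʳ k b)

  ↑ˡ<↑ʳ : (a : Fin k) (b : Fin n) → a ↑ˡ n < k ↑ʳ b
  ↑ˡ<↑ʳ a b = subst₂ ℕ._<_ (sym (Fin.toℕ-↑ˡ a n)) (sym (Fin.toℕ-↑ʳ k b))
    (ℕ.<-≤-trans (Fin.toℕ<n a) (ℕ.m≤m+n k (toℕ b)))

  ↑ˡ-fromℕ< : (x : Fin (k + n)) .(x<k : toℕ x ℕ.< k) → fromℕ< x<k ↑ˡ n ≡ x
  ↑ˡ-fromℕ< x x<k = Fin.splitAt⁻¹-↑ˡ (Fin.splitAt-< k x x<k)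

  ↑ʳ-reduce≥ : (x : Fin (k + n)) .(k≤x : k ℕ.≤ toℕ x) → k ↑ʳ reduce≥ x k≤x ≡ x
  ↑ʳ-reduce≥ x k≤x = Fin.splitAt⁻¹-↑ʳ (Fin.splitAt-≥ k x k≤x)

  data Side : Fin (k + n) → Set where
    left  : (a : Fin k) → Side (a ↑ˡ n)
    right : (b : Fin n) → Side (k ↑ʳ b)

side : ∀ k {n} (x : Fin (k + n)) → Side {k} {n} x
side zero    x       = right x
side (suc k) zero    = left zero
side (suc k) (suc x) with side k x
... | left a  = left (suc a)
... | right b = right b

module _ {k n} (τ : Perm k) (σ : Perm n) where

  lookup-⊕-↑ˡ : ∀ a → lookup (τ ⊕ σ) (a ↑ˡ n) ≡ lookup τ a ↑ˡ n
  lookup-⊕-↑ˡ a = trans (Vec.lookup-++ˡ (map (_↑ˡ n) τ) (map (k ↑ʳ_) σ) a) (Vec.lookup-map a _ τ)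

  lookup-⊕-↑ʳ : ∀ b → lookup (τ ⊕ σ) (k ↑ʳ b) ≡ k ↑ʳ lookup σ b
  lookup-⊕-↑ʳ b = trans (Vec.lookup-++ʳ (map (_↑ˡ n) τ) (map (k ↑ʳ_) σ) b) (Vec.lookup-map b _ σ)

  lookup-⊕-↑ˡ<↑ʳ : ∀ a b → lookup (τ ⊕ σ) (a ↑ˡ n) < lookup (τ ⊕ σ) (k ↑ʳ b)
  lookup-⊕-↑ˡ<↑ʳ a b = subst₂ _<_ (sym (lookup-⊕-↑ˡ a)) (sym (lookup-⊕-↑ʳ b)) (↑ˡ<↑ʳ _ _)

  occurrence-↑ˡ : Occurrence (τ ⊕ σ) τ (_↑ˡ n)
  occurrence-↑ˡ = (λ _ _ → ↑ˡ-mono-<) , λ a b →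
    ↑ˡ-cancel-< ∘ subst₂ _<_ (lookup-⊕-↑ˡ a) (lookup-⊕-↑ˡ b) ,
    subst₂ _<_ (sym (lookup-⊕-↑ˡ a)) (sym (lookup-⊕-↑ˡ b)) ∘ ↑ˡ-mono-<

  occurrence-↑ʳ : Occurrence (τ ⊕ σ) σ (k ↑ʳ_)
  occurrence-↑ʳ = (λ _ _ → ↑ʳ-mono-<) , λ a b →
    ↑ʳ-cancel-< ∘ subst₂ _<_ (lookup-⊕-↑ʳ a) (lookup-⊕-↑ʳ b) ,
    subst₂ _<_ (sym (lookup-⊕-↑ʳ a)) (sym (lookup-⊕-↑ʳ b)) ∘ ↑ʳ-mono-<

  ⊕-isPerm : IsPerm τ → IsPerm σ → IsPerm (τ ⊕ σ)
  ⊕-isPerm τ-perm σ-perm {x} {y} eq with side k x | side k y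
  ... | left a  | left a′  = cong (_↑ˡ n) (τ-perm (Fin.↑ˡ-injective n _ _
          (trans (sym (lookup-⊕-↑ˡ a)) (trans eq (lookup-⊕-↑ˡ a′)))))
  ... | right b | right b′ = cong (k ↑ʳ_) (σ-perm (Fin.↑ʳ-injective k _ _
          (trans (sym (lookup-⊕-↑ʳ b)) (trans eq (lookup-⊕-↑ʳ b′)))))
  ... | left a  | right b  = contradiction eq (ℕ.<⇒≢ (lookup-⊕-↑ˡ<↑ʳ a b) ∘ cong toℕ)
  ... | right b | left a   = contradiction (sym eq) (ℕ.<⇒≢ (lookup-⊕-↑ˡ<↑ʳ a b) ∘ cong toℕ)

  ⊕-isPermʳ : IsPerm (τ ⊕ σ) → IsPerm σ
  ⊕-isPermʳ ⊕-perm {b} {b′} eq = Fin.↑ʳ-injective k b b′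
    (⊕-perm (trans (lookup-⊕-↑ʳ b) (trans (cong (k ↑ʳ_) eq) (sym (lookup-⊕-↑ʳ b′)))))

  contains-⊕ʳ : ∀ P → Contains σ P → Contains (τ ⊕ σ) P
  contains-⊕ʳ (_ , p) (g , occ) = (k ↑ʳ_) ∘ g , occurrence-∘ {π = τ ⊕ σ} {σ} {p} occurrence-↑ʳ occ

  avoids-⊕⁻ʳ : ∀ {S} → Avoids (τ ⊕ σ) S → Avoids σ S
  avoids-⊕⁻ʳ = All.map λ {P} no-P → no-P ∘ contains-⊕ʳ P

  ⊕-below-left : ∀ {x y} → toℕ x ℕ.< k → lookup (τ ⊕ σ) y < lookup (τ ⊕ σ) x → toℕ y ℕ.< k
  ⊕-below-left {x} {y} x<k y<x with side k y
  ... | left a  = subst (ℕ._< k) (sym (Fin.toℕ-↑ˡ a n)) (Fin.toℕ<n a)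
  ... | right b = contradiction
    (subst (λ x → lookup (τ ⊕ σ) (k ↑ʳ b) < lookup (τ ⊕ σ) x) (sym (↑ˡ-fromℕ< x x<k)) y<x)
    (ℕ.<-asym (lookup-⊕-↑ˡ<↑ʳ _ b))

  ⊕-restrictˡ : ∀ {m} {p : Perm m} {f} → Occurrence (τ ⊕ σ) p f → (∀ i → toℕ (f i) ℕ.< k) →
    Contains τ (m , p)
  ⊕-restrictˡ {p = p} occ f<k = (λ i → fromℕ< (f<k i)) , occurrence-∘⁻ {π = τ ⊕ σ} {τ} {p} occurrence-↑ˡ
    (occurrence-cong {π = τ ⊕ σ} {p} (λ i → sym (↑ˡ-fromℕ< _ (f<k i))) occ)

  ⊕-restrictʳ : ∀ {m} {p : Perm (suc m)} {f} → Occurrence (τ ⊕ σ) p f → k ℕ.≤ toℕ (f 0F) →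
    Contains σ (suc m , p)
  ⊕-restrictʳ {p = p} {f} occ k≤f0 = (λ i → reduce≥ (f i) (k≤f i)) , occurrence-∘⁻ {π = τ ⊕ σ} {σ} {p}
    occurrence-↑ʳ (occurrence-cong {π = τ ⊕ σ} {p} (λ i → sym (↑ʳ-reduce≥ _ (k≤f i))) occ)
    where
    k≤f : ∀ i → k ℕ.≤ toℕ (f i)
    k≤f i = ℕ.≤-trans k≤f0 (increasing-monotone (proj₁ occ) z≤n)

  -- If q's copy starts in the σ-part, it lies in σ; otherwise the entry j, being below that
  -- start, is forced into the τ-part, which has fewer than j + 1 positions.
  ⊕-avoids : ∀ {m l} (p : Perm m) (q : Perm (suc l)) (q-in-p : Contains p (suc l , q)) →
    ¬ Contains σ (suc l , q) → (j : Fin m) → lookup p j < lookup p (proj₁ q-in-p 0F) → k ℕ.≤ toℕ j →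
    ¬ Contains (τ ⊕ σ) (m , p)
  ⊕-avoids p q (h , q-in-p) σ-avoids j pj<ph0 k≤j (f , occ) with k ℕ.≤? toℕ (f (h 0F))
  ... | yes k≤fh0 = σ-avoids (⊕-restrictʳ {p = q} (occurrence-∘ {π = τ ⊕ σ} {p} {q} occ q-in-p) k≤fh0)
  ... | no  k≰fh0 = ℕ.<-irrefl refl (ℕ.<-≤-trans fj<k (ℕ.≤-trans k≤j (increasing-inflationary (proj₁ occ) j)))
    where
    fj<k : toℕ (f j) ℕ.< k
    fj<k = ⊕-below-left (ℕ.≰⇒> k≰fh0) (proj₂ (proj₂ occ j (h 0F)) pj<ph0)

  ⊕-avoids-self : ∀ {m} (p : Perm (suc m)) → ¬ Contains σ (suc m , p) →
    (j : Fin (suc m)) → lookup p j < lookup p 0F → k ℕ.≤ toℕ j → ¬ Contains (τ ⊕ σ) (suc m , p)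
  ⊕-avoids-self p = ⊕-avoids p p (id , occurrence-refl p)

  ⊕-avoids-both : ∀ {m} (p : Perm (suc m)) → lookup p (Fin.fromℕ m) < lookup p 0F →
    ¬ Contains τ (suc m , p) → ¬ Contains σ (suc m , p) → ¬ Contains (τ ⊕ σ) (suc m , p)
  ⊕-avoids-both {m} p last<first τ-avoids σ-avoids (f , occ) with k ℕ.≤? toℕ (f 0F)
  ... | yes k≤f0 = σ-avoids (⊕-restrictʳ {p = p} occ k≤f0)
  ... | no  k≰f0 = τ-avoids (⊕-restrictˡ {p = p} occ λ i →
          ℕ.≤-<-trans (increasing-monotone (proj₁ occ) (Fin.≤fromℕ i)) f-last<k)
    where
    f-last<k : toℕ (f (Fin.fromℕ m)) ℕ.< k
    f-last<k = ⊕-below-left (ℕ.≰⇒> k≰f0) (proj₂ (proj₂ occ (Fin.fromℕ m) 0F) last<first)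

⊕-contains-⊕ : ∀ {k n a b} (τ : Perm k) (σ : Perm n) (p : Perm a) (q : Perm b) →
  Contains τ (a , p) → Contains σ (b , q) → Contains (τ ⊕ σ) (a + b , p ⊕ q)
⊕-contains-⊕ {k} {n} {a} {b} τ σ p q (f , f-occ) (g , g-occ) = h , h↑ , h≅
  where
  h : Fin (a + b) → Fin (k + n)
  h = Fin.join k n ∘ Sum.map f g ∘ Fin.splitAt a
  h-↑ˡ : ∀ i → f i ↑ˡ n ≡ h (i ↑ˡ b)
  h-↑ˡ i rewrite Fin.splitAt-↑ˡ a i b = refl
  h-↑ʳ : ∀ j → k ↑ʳ g j ≡ h (a ↑ʳ j)
  h-↑ʳ j rewrite Fin.splitAt-↑ʳ a b j = refl
  left-occ : Occurrence (τ ⊕ σ) p (h ∘ (_↑ˡ b))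
  left-occ = occurrence-cong {π = τ ⊕ σ} {p} h-↑ˡ (occurrence-∘ {π = τ ⊕ σ} {τ} {p} (occurrence-↑ˡ τ σ) f-occ)
  right-occ : Occurrence (τ ⊕ σ) q (h ∘ (a ↑ʳ_))
  right-occ = occurrence-cong {π = τ ⊕ σ} {q} h-↑ʳ (occurrence-∘ {π = τ ⊕ σ} {σ} {q} (occurrence-↑ʳ τ σ) g-occ)
  left<right : ∀ i j → h (i ↑ˡ b) < h (a ↑ʳ j)
  left<right i j = subst₂ _<_ (h-↑ˡ i) (h-↑ʳ j) (↑ˡ<↑ʳ _ _)
  left<rightᵛ : ∀ i j → lookup (τ ⊕ σ) (h (i ↑ˡ b)) < lookup (τ ⊕ σ) (h (a ↑ʳ j))
  left<rightᵛ i j = subst₂ (λ x y → lookup (τ ⊕ σ) x < lookup (τ ⊕ σ) y) (h-↑ˡ i) (h-↑ʳ j)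
    (lookup-⊕-↑ˡ<↑ʳ τ σ _ _)
  h↑ : Increasing h
  h↑ x y x<y with side a x | side a y
  ... | left i  | left i′  = proj₁ left-occ i i′ (↑ˡ-cancel-< x<y)
  ... | left i  | right j  = left<right i j
  ... | right j | left i   = contradiction x<y (ℕ.<-asym (↑ˡ<↑ʳ i j))
  ... | right j | right j′ = proj₁ right-occ j j′ (↑ʳ-cancel-< x<y)
  h≅ : ∀ x y → (lookup (τ ⊕ σ) (h x) < lookup (τ ⊕ σ) (h y) → lookup (p ⊕ q) x < lookup (p ⊕ q) y)
             × (lookup (p ⊕ q) x < lookup (p ⊕ q) y → lookup (τ ⊕ σ) (h x) < lookup (τ ⊕ σ) (h y))
  h≅ x y with side a x | side a y
  ... | left i  | left i′  = proj₂ (proj₂ (occurrence-↑ˡ p q) i i′) ∘ proj₁ (proj₂ left-occ i i′) ,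
                             proj₂ (proj₂ left-occ i i′) ∘ proj₁ (proj₂ (occurrence-↑ˡ p q) i i′)
  ... | right j | right j′ = proj₂ (proj₂ (occurrence-↑ʳ p q) j j′) ∘ proj₁ (proj₂ right-occ j j′) ,
                             proj₂ (proj₂ right-occ j j′) ∘ proj₁ (proj₂ (occurrence-↑ʳ p q) j j′)
  ... | left i  | right j  = (λ _ → lookup-⊕-↑ˡ<↑ʳ p q i j) , (λ _ → left<rightᵛ i j)
  ... | right j | left i   = (λ lt → contradiction lt (ℕ.<-asym (left<rightᵛ i j))) ,
                             (λ lt → contradiction lt (ℕ.<-asym (lookup-⊕-↑ˡ<↑ʳ p q i j)))

-- First blocks of avoiders

isPerm-via-inverse : ∀ {k} (τ τ⁻¹ : Perm k) → (∀ i → lookup τ⁻¹ (lookup τ i) ≡ i) → IsPerm τ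
isPerm-via-inverse τ τ⁻¹ τ⁻¹∘τ {i} {j} τi≡τj = trans (sym (τ⁻¹∘τ i)) (trans (cong (lookup τ⁻¹) τi≡τj) (τ⁻¹∘τ j))

position-of : ∀ {n} (π : Perm n) → IsPerm π → ∀ v → ∃ λ i → lookup π i ≡ v
position-of {suc m} π π-perm v with Fin.any? (λ i → lookup π i Fin.≟ v)
... | yes found = found
... | no  absent =
  let missed : ∀ i → v ≢ lookup π i
      missed i = absent ∘ (i ,_) ∘ sym
      (i , j , i<j , punchOuts-equal) = Fin.pigeonhole (ℕ.n<1+n m) (Fin.punchOut ∘ missed)
  in contradiction (π-perm (Fin.punchOut-injective (missed i) (missed j) punchOuts-equal)) (Fin.<⇒≢ i<j)

module _ {n} (π : Perm n) (π-perm : IsPerm π) where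

  values-distinct : ∀ {x y v} → lookup π y ≡ v → x ≢ y → lookup π x ≢ v
  values-distinct y↦v x≢y x↦v = x≢y (π-perm (trans x↦v (sym y↦v)))

  <-or-> : ∀ {i j} → i < j → lookup π i < lookup π j ⊎ lookup π j < lookup π i
  <-or-> {i} {j} i<j with Fin.<-cmp (lookup π i) (lookup π j)
  ... | tri< πi<πj _ _ = inj₁ πi<πj
  ... | tri≈ _ πi≡πj _ = contradiction (π-perm πi≡πj) (Fin.<⇒≢ i<j)
  ... | tri> _ _ πj<πi = inj₂ πj<πi

≢0⇒1≤ : ∀ {m} {x : Fin (suc m)} → x ≢ 0F → 1 ℕ.≤ toℕ x
≢0⇒1≤ {x = 0F}    x≢0 = contradiction refl x≢0
≢0⇒1≤ {x = suc _} _   = s≤s z≤n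

≢0,1⇒2≤ : ∀ {m} {x : Fin (2 + m)} → x ≢ 0F → x ≢ 1F → 2 ℕ.≤ toℕ x
≢0,1⇒2≤ {x = 0F}          x≢0 _   = contradiction refl x≢0
≢0,1⇒2≤ {x = 1F}          _   x≢1 = contradiction refl x≢1
≢0,1⇒2≤ {x = suc (suc _)} _   _   = s≤s (s≤s z≤n)

≢0,1,2⇒3≤ : ∀ {m} {x : Fin (3 + m)} → x ≢ 0F → x ≢ 1F → x ≢ 2F → 3 ℕ.≤ toℕ x
≢0,1,2⇒3≤ {x = 0F}                x≢0 _   _   = contradiction refl x≢0
≢0,1,2⇒3≤ {x = 1F}                _   x≢1 _   = contradiction refl x≢1
≢0,1,2⇒3≤ {x = 2F}                _   _   x≢2 = contradiction refl x≢2
≢0,1,2⇒3≤ {x = suc (suc (suc _))} _   _   _   = s≤s (s≤s (s≤s z≤n))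

zero-value-below : ∀ {n} (π : Perm (suc n)) → IsPerm π → ∀ {y z} →
  lookup π z ≡ 0F → y ≢ z → lookup π z < lookup π y
zero-value-below π π-perm {y} z↦0 y≢z =
  subst (_< lookup π y) (sym z↦0) (≢0⇒1≤ (values-distinct π π-perm z↦0 y≢z))

D : List Pattern
D = p231 ∷ p312 ∷ p321 ∷ []

data StartD : ∀ {n} → Perm (suc n) → Set where
  block-1  : ∀ {n} {π : Perm (suc n)} → lookup π 0F ≡ 0F → StartD π
  block-21 : ∀ {n} {π : Perm (2 + n)} → lookup π 0F ≡ 1F → lookup π 1F ≡ 0F → StartD π

data Start₃ (t₁ t₂ : Fin 3) : ∀ {n} → Perm (suc n) → Set where
  block-1  : ∀ {n} {π : Perm (suc n)} → lookup π 0F ≡ 0F → Start₃ t₁ t₂ π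
  block-21 : ∀ {n} {π : Perm (2 + n)} → lookup π 0F ≡ 1F → lookup π 1F ≡ 0F → Start₃ t₁ t₂ π
  block-3  : ∀ {n} {π : Perm (3 + n)} → lookup π 0F ≡ 2F → lookup π 1F ≡ t₁ ↑ˡ n → lookup π 2F ≡ t₂ ↑ˡ n →
             Start₃ t₁ t₂ π

module Layered {n} (π : Perm (suc n)) (π-perm : IsPerm π)
               (no-231 : ¬ Contains π p231) (no-312 : ¬ Contains π p312) where
  private
    π⟨_⟩ : Fin (suc n) → Fin (suc n)
    π⟨ i ⟩ = lookup π i

  below-head-descends : ∀ {i : Fin n} {j} → suc i < j → π⟨ j ⟩ < π⟨ 0F ⟩ →
    π⟨ j ⟩ < π⟨ suc i ⟩ × π⟨ suc i ⟩ < π⟨ 0F ⟩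
  below-head-descends i<j j<0 with <-or-> π π-perm z<s
  ... | inj₁ 0<i = contradiction (contains-231 π z<s i<j j<0 0<i) no-231
  ... | inj₂ i<0 with <-or-> π π-perm i<j
  ...   | inj₁ i<j′ = contradiction (contains-312 π z<s i<j i<j′ j<0) no-312
  ...   | inj₂ j<i  = j<i , i<0

  below-head⇒before-0 : ∀ {y z} → π⟨ z ⟩ ≡ 0F → π⟨ y ⟩ < π⟨ 0F ⟩ → y ≤ z
  below-head⇒before-0 {y} {0F}        z↦0 y<0 = contradiction (subst (π⟨ y ⟩ <_) z↦0 y<0) ℕ.n≮0
  below-head⇒before-0 {y} {z@(suc _)} z↦0 y<0 with y Fin.≤? z
  ... | yes y≤z = y≤z
  ... | no  y≰z = contradiction
    (subst (π⟨ y ⟩ <_) z↦0 (proj₁ (below-head-descends (ℕ.≰⇒> y≰z) y<0))) ℕ.n≮0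

module _ {m} (π : Perm (2 + m)) (π-perm : IsPerm π)
         (no-231 : ¬ Contains π p231) (no-312 : ¬ Contains π p312) where
  open Layered π π-perm no-231 no-312

  layered-1↦0⇒0↦1 : lookup π 1F ≡ 0F → lookup π 0F ≡ 1F
  layered-1↦0⇒0↦1 1↦0 with lookup π 0F Fin.≟ 1F
  ... | yes 0↦1 = 0↦1
  ... | no  0↦̸1 with position-of π π-perm 1F
  ...   | 0F , 0↦1 = contradiction 0↦1 0↦̸1
  ...   | 1F , 1↦1 = contradiction (trans (sym 1↦1) 1↦0) λ ()
  ...   | suc (suc y) , y↦1 = contradiction
          (below-head⇒before-0 1↦0 (subst (_< lookup π 0F) (sym y↦1) 2≤π0)) λ { (s≤s ()) }
    where
    2≤π0 : 2 ℕ.≤ toℕ (lookup π 0F)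
    2≤π0 = ≢0,1⇒2≤ (values-distinct π π-perm 1↦0 λ ()) 0↦̸1

module _ {m} (π : Perm (3 + m)) (π-perm : IsPerm π)
         (no-231 : ¬ Contains π p231) (no-312 : ¬ Contains π p312) where
  open Layered π π-perm no-231 no-312

  layered-2↦0⇒0↦2,1↦1 : lookup π 2F ≡ 0F → lookup π 0F ≡ 2F × lookup π 1F ≡ 1F
  layered-2↦0⇒0↦2,1↦1 2↦0 = 0↦2 , 1↦1
    where
    π2<π1<π0 : lookup π 2F < lookup π 1F × lookup π 1F < lookup π 0F
    π2<π1<π0 = below-head-descends (s<s z<s) (zero-value-below π π-perm 2↦0 λ ())
    1≤π1 : 1 ℕ.≤ toℕ (lookup π 1F)
    1≤π1 = subst (_< lookup π 1F) 2↦0 (proj₁ π2<π1<π0)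
    2≤π0 : 2 ℕ.≤ toℕ (lookup π 0F)
    2≤π0 = ℕ.≤-<-trans 1≤π1 (proj₂ π2<π1<π0)
    1↦1 : lookup π 1F ≡ 1F
    1↦1 with position-of π π-perm 1F
    ... | 0F , 0↦1 = contradiction (subst (λ v → 2 ℕ.≤ toℕ v) 0↦1 2≤π0) λ { (s≤s ()) }
    ... | 1F , 1↦1 = 1↦1
    ... | 2F , 2↦1 = contradiction (trans (sym 2↦0) 2↦1) λ ()
    ... | suc (suc (suc y)) , y↦1 = contradiction
          (below-head⇒before-0 2↦0 (subst (_< lookup π 0F) (sym y↦1) 2≤π0)) λ { (s≤s (s≤s ())) }
    0↦2 : lookup π 0F ≡ 2F
    0↦2 with lookup π 0F Fin.≟ 2F
    ... | yes 0↦2 = 0↦2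
    ... | no  0↦̸2 with position-of π π-perm 2F
    ...   | 0F , 0↦2 = contradiction 0↦2 0↦̸2
    ...   | 1F , 1↦2 = contradiction (trans (sym 1↦1) 1↦2) λ ()
    ...   | 2F , 2↦2 = contradiction (trans (sym 2↦0) 2↦2) λ ()
    ...   | suc (suc (suc y)) , y↦2 = contradiction
            (below-head⇒before-0 2↦0 (subst (_< lookup π 0F) (sym y↦2) 3≤π0)) λ { (s≤s (s≤s ())) }
      where
      3≤π0 : 3 ℕ.≤ toℕ (lookup π 0F)
      3≤π0 = ℕ.≤∧≢⇒< 2≤π0 (λ 2≡π0 → 0↦̸2 (Fin.toℕ-injective (sym 2≡π0)))

start-D : ∀ {n} (π : Perm (suc n)) → IsPerm π → Avoids π D → StartD π
start-D π π-perm (no-231 ∷ᴬ no-312 ∷ᴬ no-321 ∷ᴬ []ᴬ) with position-of π π-perm 0F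
... | 0F , 0↦0 = block-1 0↦0
... | 1F , 1↦0 = block-21 (layered-1↦0⇒0↦1 π π-perm no-231 no-312 1↦0) 1↦0
... | suc (suc z) , z↦0 = contradiction (contains-321 π z<s (s<s z<s) (proj₁ z<1<0) (proj₂ z<1<0)) no-321
  where
  open Layered π π-perm no-231 no-312
  z<1<0 = below-head-descends (s<s z<s) (zero-value-below π π-perm z↦0 λ ())

start-A₁ : ∀ {n} (π : Perm (suc n)) → IsPerm π → Avoids π A₁ → Start₃ 1F 0F π
start-A₁ π π-perm (no-231 ∷ᴬ no-312 ∷ᴬ no-4321 ∷ᴬ _ ∷ᴬ []ᴬ) with position-of π π-perm 0F
... | 0F , 0↦0 = block-1 0↦0
... | 1F , 1↦0 = block-21 (layered-1↦0⇒0↦1 π π-perm no-231 no-312 1↦0) 1↦0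
... | 2F , 2↦0 = block-3 (proj₁ block) (proj₂ block) 2↦0
  where block = layered-2↦0⇒0↦2,1↦1 π π-perm no-231 no-312 2↦0
... | suc (suc (suc z)) , z↦0 = contradiction
      (contains-4321 π z<s (s<s z<s) (s<s (s<s z<s)) (proj₁ z<2<0) (proj₁ 2<1<0) (proj₂ 2<1<0)) no-4321
  where
  open Layered π π-perm no-231 no-312
  z<2<0 = below-head-descends (s<s (s<s z<s)) (zero-value-below π π-perm z↦0 λ ())
  2<1<0 = below-head-descends (s<s z<s) (proj₂ z<2<0)

below-head-ascends : ∀ {n} (π : Perm (suc n)) → IsPerm π → ¬ Contains π p231 → ¬ Contains π p321 →
  ∀ {i : Fin n} {j} → suc i < j → lookup π j < lookup π 0F → lookup π (suc i) < lookup π j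
below-head-ascends π π-perm no-231 no-321 i<j j<0 with <-or-> π π-perm z<s
... | inj₁ 0<i = contradiction (contains-231 π z<s i<j j<0 0<i) no-231
... | inj₂ i<0 with <-or-> π π-perm i<j
...   | inj₁ i<j′ = i<j′
...   | inj₂ j<i  = contradiction (contains-321 π z<s i<j j<i i<0) no-321

module _ {m} (π : Perm (2 + m)) (π-perm : IsPerm π) (no-231 : ¬ Contains π p231)
         (no-321 : ¬ Contains π p321) (no-4123 : ¬ Contains π p4123) (1↦0 : lookup π 1F ≡ 0F) where
  private
    ascends = below-head-ascends π π-perm no-231 no-321
    distinct = values-distinct π π-perm

  start-A₂-1↦0 : Start₃ 0F 1F π
  start-A₂-1↦0 with position-of π π-perm 1F
  ... | 0F , 0↦1 = block-21 0↦1 1↦0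
  ... | 1F , 1↦1 = contradiction (trans (sym 1↦1) 1↦0) λ ()
  ... | suc (suc (suc y)) , y↦1 = contradiction
        (ℕ.≤-<-trans (≢0⇒1≤ (distinct 1↦0 λ ())) (subst (lookup π 2F <_) y↦1 π2<πy)) (ℕ.<-irrefl refl)
    where
    π2<πy : lookup π 2F < lookup π (suc (suc (suc y)))
    π2<πy = ascends (s<s (s<s z<s))
      (subst (_< lookup π 0F) (sym y↦1) (≢0,1⇒2≤ (distinct 1↦0 λ ()) (distinct y↦1 λ ())))
  ... | 2F , 2↦1 with position-of π π-perm 2F
  ...   | 0F , 0↦2 = block-3 0↦2 1↦0 2↦1
  ...   | 1F , 1↦2 = contradiction (trans (sym 1↦0) 1↦2) λ ()
  ...   | 2F , 2↦2 = contradiction (trans (sym 2↦1) 2↦2) λ ()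
  ...   | 3F , 3↦2 = contradiction (contains-4123 π z<s (s<s z<s) (s<s (s<s z<s))
          (subst₂ _<_ (sym 1↦0) (sym 2↦1) z<s) (subst₂ _<_ (sym 2↦1) (sym 3↦2) (s<s z<s))
          (subst (_< lookup π 0F) (sym 3↦2) 3≤π0)) no-4123
    where
    3≤π0 : 3 ℕ.≤ toℕ (lookup π 0F)
    3≤π0 = ≢0,1,2⇒3≤ (distinct 1↦0 λ ()) (distinct 2↦1 λ ()) (distinct 3↦2 λ ())
  ...   | suc (suc (suc (suc y))) , y↦2 = contradiction
          (ℕ.<-≤-trans (subst (lookup π 3F <_) y↦2 π3<πy) 2≤π3) (ℕ.<-irrefl refl)
    where
    π3<πy : lookup π 3F < lookup π (suc (suc (suc (suc y))))
    π3<πy = ascends (s<s (s<s (s<s z<s))) (subst (_< lookup π 0F) (sym y↦2)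
      (≢0,1,2⇒3≤ (distinct 1↦0 λ ()) (distinct 2↦1 λ ()) (distinct y↦2 λ ())))
    2≤π3 : 2 ℕ.≤ toℕ (lookup π 3F)
    2≤π3 = ≢0,1⇒2≤ (distinct 1↦0 λ ()) (distinct 2↦1 λ ())

start-A₂ : ∀ {n} (π : Perm (suc n)) → IsPerm π → Avoids π A₂ → Start₃ 0F 1F π
start-A₂ π π-perm (no-231 ∷ᴬ no-321 ∷ᴬ no-4123 ∷ᴬ _ ∷ᴬ []ᴬ) with position-of π π-perm 0F
... | 0F , 0↦0 = block-1 0↦0
... | 1F , 1↦0 = start-A₂-1↦0 π π-perm no-231 no-321 no-4123 1↦0
... | suc (suc z) , z↦0 = contradiction (subst (lookup π 1F <_) z↦0 π1<πz) ℕ.n≮0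
  where
  π1<πz : lookup π 1F < lookup π (suc (suc z))
  π1<πz = below-head-ascends π π-perm no-231 no-321 (s<s z<s) (zero-value-below π π-perm z↦0 λ ())

-- Removing the first block

Av-≡ : ∀ {n S} {π π′ : Av n S} → Av.perm π ≡ Av.perm π′ → π ≡ π′
Av-≡ {π = mkAv _ _ _} {mkAv _ _ _} refl = refl

module Block {k} (τ : Perm k) (τ-perm : IsPerm τ) {S T : List Pattern}
  (after  : ∀ {n} {σ : Perm n} → Avoids σ T → Avoids (τ ⊕ σ) S)
  (after⁻ : ∀ {n} {σ : Perm n} → Avoids (τ ⊕ σ) S → Avoids σ T) where

  prepend : ∀ {n} → Av n T → Av (k + n) S
  prepend (mkAv σ σ-perm σ-avoids) = mkAv (τ ⊕ σ) (⊕-isPerm τ σ τ-perm σ-perm) (after σ-avoids)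

  module _ {n} (rest : Vec (Fin (k + n)) n) where
    private
      prefix : Vec (Fin (k + n)) k
      prefix = map (_↑ˡ n) τ

    -- A value below k in rest would repeat a value of the prefix, as τ is onto Fin k.
    rest-≥ : IsPerm (prefix ++ rest) → ∀ i → k ℕ.≤ toℕ (lookup rest i)
    rest-≥ π-perm i with k ℕ.≤? toℕ (lookup rest i)
    ... | yes k≤ = k≤
    ... | no  k≰ = contradiction (π-perm same-value) (ℕ.<⇒≢ (↑ˡ<↑ʳ x i) ∘ cong toℕ)
      where
      v<k = ℕ.≰⇒> k≰
      x = proj₁ (position-of τ τ-perm (fromℕ< v<k))
      same-value : lookup (prefix ++ rest) (x ↑ˡ n) ≡ lookup (prefix ++ rest) (k ↑ʳ i)
      same-value = begin
        lookup (prefix ++ rest) (x ↑ˡ n) ≡⟨ Vec.lookup-++ˡ prefix rest x ⟩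
        lookup prefix x                   ≡⟨ Vec.lookup-map x (_↑ˡ n) τ ⟩
        lookup τ x ↑ˡ n                   ≡⟨ cong (_↑ˡ n) (proj₂ (position-of τ τ-perm (fromℕ< v<k))) ⟩
        fromℕ< v<k ↑ˡ n                   ≡⟨ ↑ˡ-fromℕ< (lookup rest i) v<k ⟩
        lookup rest i                     ≡⟨ Vec.lookup-++ʳ prefix rest i ⟨
        lookup (prefix ++ rest) (k ↑ʳ i)  ∎
        where open ≡-Reasoning

    module _ .(π-perm : IsPerm (prefix ++ rest)) where
      tail : Perm n
      tail = tabulate λ i → reduce≥ (lookup rest i) (rest-≥ π-perm i)

      ⊕-tail : τ ⊕ tail ≡ prefix ++ rest
      ⊕-tail = cong (prefix ++_) (begin
        map (k ↑ʳ_) tail                                                ≡⟨ Vec.tabulate-∘ _ _ ⟨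
        tabulate (λ i → k ↑ʳ reduce≥ (lookup rest i) (rest-≥ π-perm i)) ≡⟨ Vec.tabulate-cong (λ i →
                                                                             ↑ʳ-reduce≥ {k} (lookup rest i) _) ⟩
        tabulate (lookup rest)                                          ≡⟨ Vec.tabulate∘lookup rest ⟩
        rest                                                            ∎)
        where open ≡-Reasoning

    strip : ∀ {π} → .(π ≡ prefix ++ rest) → .(IsPerm π) → .(Avoids π S) → Av n T
    strip π≡ π-perm π-avoids = mkAv (tail (subst IsPerm π≡ π-perm))
      (⊕-isPermʳ τ _ (subst IsPerm (trans π≡ (sym (⊕-tail (subst IsPerm π≡ π-perm)))) π-perm))
      (after⁻ (subst (λ π → Avoids π S) (trans π≡ (sym (⊕-tail (subst IsPerm π≡ π-perm)))) π-avoids))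

    prepend-strip : ∀ {π} (π≡ : π ≡ prefix ++ rest) .(π-perm : IsPerm π) .(π-avoids : Avoids π S) →
      Av.perm (prepend (strip π≡ π-perm π-avoids)) ≡ π
    prepend-strip π≡ π-perm _ = trans (⊕-tail (subst IsPerm π≡ π-perm)) (sym π≡)

  strip-prepend : ∀ {n} (σ : Perm n) .(σ-perm : IsPerm σ) .(σ-avoids : Avoids σ T) →
    strip (map (k ↑ʳ_) σ) refl (⊕-isPerm τ σ τ-perm σ-perm) (after σ-avoids) ≡ mkAv σ σ-perm σ-avoids
  strip-prepend σ σ-perm _ = Av-≡ (begin
    tail (map (k ↑ʳ_) σ) (⊕-isPerm τ σ τ-perm σ-perm) ≡⟨ Vec.tabulate-cong tail-entry ⟩
    tabulate (lookup σ)                                 ≡⟨ Vec.tabulate∘lookup σ ⟩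
    σ                                                   ∎)
    where
    open ≡-Reasoning
    tail-entry : ∀ i → reduce≥ (lookup (map (k ↑ʳ_) σ) i) _ ≡ lookup σ i
    tail-entry i = Fin.↑ʳ-injective k _ _ (begin
      k ↑ʳ reduce≥ (lookup (map (k ↑ʳ_) σ) i) _ ≡⟨ ↑ʳ-reduce≥ {k} (lookup (map (k ↑ʳ_) σ) i) _ ⟩
      lookup (map (k ↑ʳ_) σ) i                  ≡⟨ Vec.lookup-map i _ σ ⟩
      k ↑ʳ lookup σ i                           ∎)

-- Counting

-- Av (n ∸ d) T, except that it is empty when n < d.
Av∸ : ℕ → ℕ → List Pattern → Set
Av∸ n       zero    T = Av n T
Av∸ zero    (suc d) T = ⊥
Av∸ (suc n) (suc d) T = Av∸ n d T

Av-[] : ∀ {S} → Avoids [] S → Av 0 S ↔ Fin 1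
Av-[] []-avoids-S = mk↔ₛ′ (λ _ → 0F) (λ _ → mkAv [] (λ {}) []-avoids-S)
  (λ { 0F → refl ; (suc ()) }) (λ { (mkAv [] _ _) → refl })

[]-avoids : ∀ {m} (p : Perm (suc m)) → ¬ Contains [] (suc m , p)
[]-avoids p (f , _) with f 0F
... | ()

⊎-count : ∀ {A B : Set} {a b} → A ↔ Fin a → B ↔ Fin b → (A ⊎ B) ↔ Fin (a + b)
⊎-count A↔ B↔ = ↔-trans (A↔ ⊎-↔ B↔) (↔-sym Fin.+↔⊎)

⊥↔Fin0 : ⊥ ↔ Fin 0
⊥↔Fin0 = ↔-sym Fin.0↔⊥

F-positive : ∀ n → 1 ℕ.≤ F n
F-positive zero          = s≤s z≤n
F-positive (suc zero)    = s≤s z≤n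
F-positive (suc (suc n)) = ℕ.≤-trans (F-positive (suc n)) (ℕ.m≤m+n _ _)

F-pred-step : ∀ n → (F (3 + n) ∸ 1) + F (2 + n) ≡ F (4 + n) ∸ 1
F-pred-step n = sym (ℕ.+-∸-comm (F (2 + n)) (F-positive (3 + n)))

τ₁ : Perm 1
τ₁ = 0F ∷ []

τ₁-perm : IsPerm τ₁
τ₁-perm = isPerm-via-inverse τ₁ τ₁ λ { 0F → refl }

p21-perm : IsPerm p21
p21-perm = isPerm-via-inverse p21 p21 λ { 0F → refl ; 1F → refl }

module D-blocks where
  after-1 : ∀ {n} {σ : Perm n} → Avoids σ D → Avoids (τ₁ ⊕ σ) D
  after-1 {σ = σ} (no-231 ∷ᴬ no-312 ∷ᴬ no-321 ∷ᴬ []ᴬ) =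
    ⊕-avoids-self τ₁ σ (proj₂ p231) no-231 2F z<s (s≤s z≤n) ∷ᴬ
    ⊕-avoids-self τ₁ σ (proj₂ p312) no-312 1F z<s (s≤s z≤n) ∷ᴬ
    ⊕-avoids-self τ₁ σ (proj₂ p321) no-321 1F (s<s z<s) (s≤s z≤n) ∷ᴬ []ᴬ

  after-21 : ∀ {n} {σ : Perm n} → Avoids σ D → Avoids (p21 ⊕ σ) D
  after-21 {σ = σ} (no-231 ∷ᴬ no-312 ∷ᴬ no-321 ∷ᴬ []ᴬ) =
    ⊕-avoids-self p21 σ (proj₂ p231) no-231 2F z<s (s≤s (s≤s z≤n)) ∷ᴬ
    ⊕-avoids-self p21 σ (proj₂ p312) no-312 2F (s<s z<s) (s≤s (s≤s z≤n)) ∷ᴬ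
    ⊕-avoids-self p21 σ (proj₂ p321) no-321 2F z<s (s≤s (s≤s z≤n)) ∷ᴬ []ᴬ

module D-count where
  private
    module B₁  = Block τ₁  τ₁-perm  D-blocks.after-1  (avoids-⊕⁻ʳ τ₁ _)
    module B₂₁ = Block p21 p21-perm D-blocks.after-21 (avoids-⊕⁻ʳ p21 _)

    -- The fields of Av are irrelevant, so the shape of the first block is recovered by deciding it.
    shape-21 : ∀ {m b} {rest : Vec (Fin (2 + m)) m} →
      .(IsPerm (1F ∷ b ∷ rest)) → .(Avoids (1F ∷ b ∷ rest) D) → 1F ∷ b ∷ rest ≡ 1F ∷ 0F ∷ rest
    shape-21 {b = b} {rest} π-perm π-avoids =
      recompute (Vec.≡-dec Fin._≟_ _ _) (shape (start-D _ π-perm π-avoids))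
      where
      shape : StartD (1F ∷ b ∷ rest) → 1F ∷ b ∷ rest ≡ 1F ∷ 0F ∷ rest
      shape (block-21 _ b≡0) = cong (λ b → 1F ∷ b ∷ rest) b≡0

    head≤1 : ∀ {n} {x : Fin n} {rest} → StartD (suc (suc x) ∷ rest) → ⊥
    head≤1 (block-1 ())
    head≤1 (block-21 () _)

    to : ∀ {n} → Av (suc n) D → Av n D ⊎ Av∸ n 1 D
    to (mkAv (0F ∷ rest) π-perm π-avoids) = inj₁ (B₁.strip rest refl π-perm π-avoids)
    to (mkAv (1F ∷ b ∷ rest) π-perm π-avoids) =
      inj₂ (B₂₁.strip rest (shape-21 π-perm π-avoids) π-perm π-avoids)
    to (mkAv (suc (suc _) ∷ _) π-perm π-avoids) = ⊥-elim-irr (head≤1 (start-D _ π-perm π-avoids))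

    from : ∀ {n} → Av n D ⊎ Av∸ n 1 D → Av (suc n) D
    from (inj₁ σ) = B₁.prepend σ
    from {suc _} (inj₂ σ) = B₂₁.prepend σ

    to∘from : ∀ {n} (σ : Av n D ⊎ Av∸ n 1 D) → to (from σ) ≡ σ
    to∘from (inj₁ (mkAv σ σ-perm σ-avoids)) = cong inj₁ (B₁.strip-prepend σ σ-perm σ-avoids)
    to∘from {suc _} (inj₂ (mkAv σ σ-perm σ-avoids)) = cong inj₂ (B₂₁.strip-prepend σ σ-perm σ-avoids)

    from∘to : ∀ {n} (π : Av (suc n) D) → from (to π) ≡ π
    from∘to (mkAv (0F ∷ rest) π-perm π-avoids) = Av-≡ (B₁.prepend-strip rest refl π-perm π-avoids)
    from∘to (mkAv (1F ∷ b ∷ rest) π-perm π-avoids) =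
      Av-≡ (B₂₁.prepend-strip rest (shape-21 π-perm π-avoids) π-perm π-avoids)
    from∘to (mkAv (suc (suc _) ∷ _) π-perm π-avoids) = ⊥-elim-irr (head≤1 (start-D _ π-perm π-avoids))

  decomposition : ∀ n → Av (suc n) D ↔ (Av n D ⊎ Av∸ n 1 D)
  decomposition n = mk↔ₛ′ to from to∘from from∘to

  |Av-D| : ∀ n → Av n D ↔ Fin (F n)
  |Av-D| zero          = Av-[] ([]-avoids (proj₂ p231) ∷ᴬ []-avoids (proj₂ p312) ∷ᴬ []-avoids (proj₂ p321) ∷ᴬ []ᴬ)
  |Av-D| (suc zero)    = ↔-trans (decomposition 0) (⊎-count (|Av-D| 0) ⊥↔Fin0)
  |Av-D| (suc (suc n)) = ↔-trans (decomposition (suc n)) (⊎-count (|Av-D| (suc n)) (|Av-D| n))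

module Count₃ {S : List Pattern} {t₁ t₂ : Fin 3}
  (τ₃-perm     : IsPerm (2F ∷ t₁ ∷ t₂ ∷ []))
  (start       : ∀ {n} (π : Perm (suc n)) → IsPerm π → Avoids π S → Start₃ t₁ t₂ π)
  ([]-avoids-S : Avoids [] S)
  (after-1     : ∀ {n} {σ : Perm n} → Avoids σ S → Avoids (τ₁ ⊕ σ) S)
  (after-21    : ∀ {n} {σ : Perm n} → Avoids σ D → Avoids (p21 ⊕ σ) S)
  (after-21⁻   : ∀ {n} {σ : Perm n} → Avoids (p21 ⊕ σ) S → Avoids σ D)
  (after-3     : ∀ {n} {σ : Perm n} → Avoids σ D → Avoids ((2F ∷ t₁ ∷ t₂ ∷ []) ⊕ σ) S)
  (after-3⁻    : ∀ {n} {σ : Perm n} → Avoids ((2F ∷ t₁ ∷ t₂ ∷ []) ⊕ σ) S → Avoids σ D) where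
  private
    module B₁  = Block τ₁  τ₁-perm  after-1  (avoids-⊕⁻ʳ τ₁ _)
    module B₂₁ = Block p21 p21-perm after-21 after-21⁻
    module B₃  = Block (2F ∷ t₁ ∷ t₂ ∷ []) τ₃-perm after-3 after-3⁻

    shape-21 : ∀ {m b} {rest : Vec (Fin (2 + m)) m} →
      .(IsPerm (1F ∷ b ∷ rest)) → .(Avoids (1F ∷ b ∷ rest) S) → 1F ∷ b ∷ rest ≡ 1F ∷ 0F ∷ rest
    shape-21 {b = b} {rest} π-perm π-avoids =
      recompute (Vec.≡-dec Fin._≟_ _ _) (shape (start _ π-perm π-avoids))
      where
      shape : Start₃ t₁ t₂ (1F ∷ b ∷ rest) → 1F ∷ b ∷ rest ≡ 1F ∷ 0F ∷ rest
      shape (block-21 _ b≡0) = cong (λ b → 1F ∷ b ∷ rest) b≡0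

    shape-3 : ∀ {m b c} {rest : Vec (Fin (3 + m)) m} → .(IsPerm (2F ∷ b ∷ c ∷ rest)) →
      .(Avoids (2F ∷ b ∷ c ∷ rest) S) → 2F ∷ b ∷ c ∷ rest ≡ 2F ∷ (t₁ ↑ˡ m) ∷ (t₂ ↑ˡ m) ∷ rest
    shape-3 {b = b} {c} {rest} π-perm π-avoids =
      recompute (Vec.≡-dec Fin._≟_ _ _) (shape (start _ π-perm π-avoids))
      where
      shape : Start₃ t₁ t₂ (2F ∷ b ∷ c ∷ rest) → 2F ∷ b ∷ c ∷ rest ≡ 2F ∷ _ ∷ _ ∷ rest
      shape (block-3 _ b≡t₁ c≡t₂) = cong₂ (λ b c → 2F ∷ b ∷ c ∷ rest) b≡t₁ c≡t₂

    head≤2 : ∀ {n} {x : Fin n} {rest} → Start₃ t₁ t₂ (suc (suc (suc x)) ∷ rest) → ⊥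
    head≤2 (block-1 ())
    head≤2 (block-21 () _)
    head≤2 (block-3 () _ _)

    to : ∀ {n} → Av (suc n) S → Av n S ⊎ Av∸ n 1 D ⊎ Av∸ n 2 D
    to (mkAv (0F ∷ rest) π-perm π-avoids) = inj₁ (B₁.strip rest refl π-perm π-avoids)
    to (mkAv (1F ∷ b ∷ rest) π-perm π-avoids) =
      inj₂ (inj₁ (B₂₁.strip rest (shape-21 π-perm π-avoids) π-perm π-avoids))
    to (mkAv (2F ∷ b ∷ c ∷ rest) π-perm π-avoids) =
      inj₂ (inj₂ (B₃.strip rest (shape-3 π-perm π-avoids) π-perm π-avoids))
    to (mkAv (suc (suc (suc _)) ∷ _) π-perm π-avoids) = ⊥-elim-irr (head≤2 (start _ π-perm π-avoids))

    from : ∀ {n} → Av n S ⊎ Av∸ n 1 D ⊎ Av∸ n 2 D → Av (suc n) S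
    from (inj₁ σ) = B₁.prepend σ
    from {suc _} (inj₂ (inj₁ σ)) = B₂₁.prepend σ
    from {suc (suc _)} (inj₂ (inj₂ σ)) = B₃.prepend σ
    from {suc zero} (inj₂ (inj₂ ()))

    to∘from : ∀ {n} (σ : Av n S ⊎ Av∸ n 1 D ⊎ Av∸ n 2 D) → to (from σ) ≡ σ
    to∘from (inj₁ (mkAv σ σ-perm σ-avoids)) = cong inj₁ (B₁.strip-prepend σ σ-perm σ-avoids)
    to∘from {suc _} (inj₂ (inj₁ (mkAv σ σ-perm σ-avoids))) =
      cong (inj₂ ∘ inj₁) (B₂₁.strip-prepend σ σ-perm σ-avoids)
    to∘from {suc (suc _)} (inj₂ (inj₂ (mkAv σ σ-perm σ-avoids))) =
      cong (inj₂ ∘ inj₂) (B₃.strip-prepend σ σ-perm σ-avoids)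
    to∘from {suc zero} (inj₂ (inj₂ ()))

    from∘to : ∀ {n} (π : Av (suc n) S) → from (to π) ≡ π
    from∘to (mkAv (0F ∷ rest) π-perm π-avoids) = Av-≡ (B₁.prepend-strip rest refl π-perm π-avoids)
    from∘to (mkAv (1F ∷ b ∷ rest) π-perm π-avoids) =
      Av-≡ (B₂₁.prepend-strip rest (shape-21 π-perm π-avoids) π-perm π-avoids)
    from∘to (mkAv (2F ∷ b ∷ c ∷ rest) π-perm π-avoids) =
      Av-≡ (B₃.prepend-strip rest (shape-3 π-perm π-avoids) π-perm π-avoids)
    from∘to (mkAv (suc (suc (suc _)) ∷ _) π-perm π-avoids) = ⊥-elim-irr (head≤2 (start _ π-perm π-avoids))

  decomposition : ∀ n → Av (suc n) S ↔ (Av n S ⊎ Av∸ n 1 D ⊎ Av∸ n 2 D)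
  decomposition n = mk↔ₛ′ to from to∘from from∘to

  open D-count using (|Av-D|)

  |Av| : ∀ n → Av (suc n) S ↔ Fin (F (2 + n) ∸ 1)
  |Av| zero          = ↔-trans (decomposition 0) (⊎-count (Av-[] []-avoids-S) (⊎-count ⊥↔Fin0 ⊥↔Fin0))
  |Av| (suc zero)    = ↔-trans (decomposition 1) (⊎-count (|Av| 0) (⊎-count (|Av-D| 0) ⊥↔Fin0))
  |Av| (suc (suc n)) = ↔-trans (decomposition (2 + n))
    (subst (λ c → (Av (2 + n) S ⊎ Av (1 + n) D ⊎ Av n D) ↔ Fin c) (F-pred-step n)
      (⊎-count (|Av| (suc n)) (⊎-count (|Av-D| (suc n)) (|Av-D| n))))

module A₁-blocks where
  τ₃ : Perm 3
  τ₃ = 2F ∷ 1F ∷ 0F ∷ []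

  τ₃-perm : IsPerm τ₃
  τ₃-perm = isPerm-via-inverse τ₃ τ₃ λ { 0F → refl ; 1F → refl ; 2F → refl }

  after-1 : ∀ {n} {σ : Perm n} → Avoids σ A₁ → Avoids (τ₁ ⊕ σ) A₁
  after-1 {σ = σ} (no-231 ∷ᴬ no-312 ∷ᴬ no-4321 ∷ᴬ no-21543 ∷ᴬ []ᴬ) =
    ⊕-avoids-self τ₁ σ (proj₂ p231) no-231 2F z<s (s≤s z≤n) ∷ᴬ
    ⊕-avoids-self τ₁ σ (proj₂ p312) no-312 1F z<s (s≤s z≤n) ∷ᴬ
    ⊕-avoids-self τ₁ σ (proj₂ p4321) no-4321 1F (s<s (s<s z<s)) (s≤s z≤n) ∷ᴬ
    ⊕-avoids-self τ₁ σ (proj₂ p21543) no-21543 1F z<s (s≤s z≤n) ∷ᴬ []ᴬ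

  after-21 : ∀ {n} {σ : Perm n} → Avoids σ D → Avoids (p21 ⊕ σ) A₁
  after-21 {σ = σ} (no-231 ∷ᴬ no-312 ∷ᴬ no-321 ∷ᴬ []ᴬ) =
    ⊕-avoids-self p21 σ (proj₂ p231) no-231 2F z<s (s≤s (s≤s z≤n)) ∷ᴬ
    ⊕-avoids-self p21 σ (proj₂ p312) no-312 2F (s<s z<s) (s≤s (s≤s z≤n)) ∷ᴬ
    ⊕-avoids-self p21 σ (proj₂ p4321) (avoids-sub σ p4321 p321 321-in-4321 no-321)
      2F (s<s z<s) (s≤s (s≤s z≤n)) ∷ᴬ
    ⊕-avoids p21 σ (proj₂ p21543) (proj₂ p321) 321-in-21543 no-321
      3F (s<s (s<s (s<s z<s))) (s≤s (s≤s z≤n)) ∷ᴬ []ᴬ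

  after-21⁻ : ∀ {n} {σ : Perm n} → Avoids (p21 ⊕ σ) A₁ → Avoids σ D
  after-21⁻ {σ = σ} (no-231 ∷ᴬ no-312 ∷ᴬ _ ∷ᴬ no-21543 ∷ᴬ []ᴬ) =
    no-231 ∘ contains-⊕ʳ p21 σ p231 ∷ᴬ
    no-312 ∘ contains-⊕ʳ p21 σ p312 ∷ᴬ
    no-21543 ∘ ⊕-contains-⊕ p21 σ p21 (proj₂ p321) (contains-21 p21 {0F} {1F} z<s z<s) ∷ᴬ []ᴬ

  after-3 : ∀ {n} {σ : Perm n} → Avoids σ D → Avoids (τ₃ ⊕ σ) A₁
  after-3 {σ = σ} (no-231 ∷ᴬ no-312 ∷ᴬ no-321 ∷ᴬ []ᴬ) =
    ⊕-avoids-both τ₃ σ (proj₂ p231) z<s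
      (avoids-same-length τ₃ (proj₂ p231) 0F 1F (s<s z<s) λ { (s≤s ()) }) no-231 ∷ᴬ
    ⊕-avoids-both τ₃ σ (proj₂ p312) (s<s z<s)
      (avoids-same-length τ₃ (proj₂ p312) 1F 2F z<s λ ()) no-312 ∷ᴬ
    ⊕-avoids-self τ₃ σ (proj₂ p4321) (avoids-sub σ p4321 p321 321-in-4321 no-321)
      3F z<s (s≤s (s≤s (s≤s z≤n))) ∷ᴬ
    ⊕-avoids τ₃ σ (proj₂ p21543) (proj₂ p321) 321-in-21543 no-321
      3F (s<s (s<s (s<s z<s))) (s≤s (s≤s (s≤s z≤n))) ∷ᴬ []ᴬ

  after-3⁻ : ∀ {n} {σ : Perm n} → Avoids (τ₃ ⊕ σ) A₁ → Avoids σ D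
  after-3⁻ {σ = σ} (no-231 ∷ᴬ no-312 ∷ᴬ _ ∷ᴬ no-21543 ∷ᴬ []ᴬ) =
    no-231 ∘ contains-⊕ʳ τ₃ σ p231 ∷ᴬ
    no-312 ∘ contains-⊕ʳ τ₃ σ p312 ∷ᴬ
    no-21543 ∘ ⊕-contains-⊕ τ₃ σ p21 (proj₂ p321) (contains-21 τ₃ {0F} {1F} z<s (s<s z<s)) ∷ᴬ []ᴬ

module A₂-blocks where
  τ₃ : Perm 3
  τ₃ = 2F ∷ 0F ∷ 1F ∷ []

  τ₃-perm : IsPerm τ₃
  τ₃-perm = isPerm-via-inverse τ₃ (1F ∷ 2F ∷ 0F ∷ []) λ { 0F → refl ; 1F → refl ; 2F → refl }

  after-1 : ∀ {n} {σ : Perm n} → Avoids σ A₂ → Avoids (τ₁ ⊕ σ) A₂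
  after-1 {σ = σ} (no-231 ∷ᴬ no-321 ∷ᴬ no-4123 ∷ᴬ no-21534 ∷ᴬ []ᴬ) =
    ⊕-avoids-self τ₁ σ (proj₂ p231) no-231 2F z<s (s≤s z≤n) ∷ᴬ
    ⊕-avoids-self τ₁ σ (proj₂ p321) no-321 1F (s<s z<s) (s≤s z≤n) ∷ᴬ
    ⊕-avoids-self τ₁ σ (proj₂ p4123) no-4123 1F z<s (s≤s z≤n) ∷ᴬ
    ⊕-avoids-self τ₁ σ (proj₂ p21534) no-21534 1F z<s (s≤s z≤n) ∷ᴬ []ᴬ

  after-21 : ∀ {n} {σ : Perm n} → Avoids σ D → Avoids (p21 ⊕ σ) A₂
  after-21 {σ = σ} (no-231 ∷ᴬ no-312 ∷ᴬ no-321 ∷ᴬ []ᴬ) =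
    ⊕-avoids-self p21 σ (proj₂ p231) no-231 2F z<s (s≤s (s≤s z≤n)) ∷ᴬ
    ⊕-avoids-self p21 σ (proj₂ p321) no-321 2F z<s (s≤s (s≤s z≤n)) ∷ᴬ
    ⊕-avoids-self p21 σ (proj₂ p4123) (avoids-sub σ p4123 p312 312-in-4123 no-312)
      2F (s<s z<s) (s≤s (s≤s z≤n)) ∷ᴬ
    ⊕-avoids p21 σ (proj₂ p21534) (proj₂ p312) 312-in-21534 no-312
      3F (s<s (s<s z<s)) (s≤s (s≤s z≤n)) ∷ᴬ []ᴬ

  after-21⁻ : ∀ {n} {σ : Perm n} → Avoids (p21 ⊕ σ) A₂ → Avoids σ D
  after-21⁻ {σ = σ} (no-231 ∷ᴬ no-321 ∷ᴬ _ ∷ᴬ no-21534 ∷ᴬ []ᴬ) =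
    no-231 ∘ contains-⊕ʳ p21 σ p231 ∷ᴬ
    no-21534 ∘ ⊕-contains-⊕ p21 σ p21 (proj₂ p312) (contains-21 p21 {0F} {1F} z<s z<s) ∷ᴬ
    no-321 ∘ contains-⊕ʳ p21 σ p321 ∷ᴬ []ᴬ

  after-3 : ∀ {n} {σ : Perm n} → Avoids σ D → Avoids (τ₃ ⊕ σ) A₂
  after-3 {σ = σ} (no-231 ∷ᴬ no-312 ∷ᴬ no-321 ∷ᴬ []ᴬ) =
    ⊕-avoids-both τ₃ σ (proj₂ p231) z<s
      (avoids-same-length τ₃ (proj₂ p231) 0F 1F (s<s z<s) λ ()) no-231 ∷ᴬ
    ⊕-avoids-both τ₃ σ (proj₂ p321) z<s
      (avoids-same-length τ₃ (proj₂ p321) 2F 1F z<s λ ()) no-321 ∷ᴬ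
    ⊕-avoids-self τ₃ σ (proj₂ p4123) (avoids-sub σ p4123 p312 312-in-4123 no-312)
      3F (s<s (s<s z<s)) (s≤s (s≤s (s≤s z≤n))) ∷ᴬ
    ⊕-avoids τ₃ σ (proj₂ p21534) (proj₂ p312) 312-in-21534 no-312
      3F (s<s (s<s z<s)) (s≤s (s≤s (s≤s z≤n))) ∷ᴬ []ᴬ

  after-3⁻ : ∀ {n} {σ : Perm n} → Avoids (τ₃ ⊕ σ) A₂ → Avoids σ D
  after-3⁻ {σ = σ} (no-231 ∷ᴬ no-321 ∷ᴬ _ ∷ᴬ no-21534 ∷ᴬ []ᴬ) =
    no-231 ∘ contains-⊕ʳ τ₃ σ p231 ∷ᴬ
    no-21534 ∘ ⊕-contains-⊕ τ₃ σ p21 (proj₂ p312) (contains-21 τ₃ {0F} {1F} z<s z<s) ∷ᴬ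
    no-321 ∘ contains-⊕ʳ τ₃ σ p321 ∷ᴬ []ᴬ

module A₁-count = Count₃ A₁-blocks.τ₃-perm start-A₁
  ([]-avoids (proj₂ p231) ∷ᴬ []-avoids (proj₂ p312) ∷ᴬ []-avoids (proj₂ p4321) ∷ᴬ []-avoids (proj₂ p21543) ∷ᴬ []ᴬ)
  A₁-blocks.after-1 A₁-blocks.after-21 A₁-blocks.after-21⁻ A₁-blocks.after-3 A₁-blocks.after-3⁻

module A₂-count = Count₃ A₂-blocks.τ₃-perm start-A₂
  ([]-avoids (proj₂ p231) ∷ᴬ []-avoids (proj₂ p321) ∷ᴬ []-avoids (proj₂ p4123) ∷ᴬ []-avoids (proj₂ p21534) ∷ᴬ []ᴬ)
  A₂-blocks.after-1 A₂-blocks.after-21 A₂-blocks.after-21⁻ A₂-blocks.after-3 A₂-blocks.after-3⁻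

theorem2p4 : ∀ (n : ℕ) → n ≥ 1 →
    (Av n A₁ ↔ Fin (F (suc n) ∸ 1)) × (Av n A₂ ↔ Fin (F (suc n) ∸ 1))
theorem2p4 (suc n) _ = A₁-count.|Av| n , A₂-count.|Av| n
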